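{- Let $G$ be a connected graph of order $n \ge 4$. Then $\mathrm{sroy}(\mathrm{cor}(G)) \le \mathrm{sroy}(G) + 1$. Consequently, if $G$ is a royal-zero graph, then so is $\mathrm{cor}(G)$.
   Context: For a positive integer $k$, let $[k]=\{1,\dots,k\}$ and let $\mathcal{P}^*([k])$ denote the set of the $2^k-1$ nonempty subsets of $[k]$. For a connected graph $G$ of order at least $3$, an edge coloring $c:E(G)\to\mathcal{P}^*([k])$ induces the vertex coloring $c':V(G)\to\mathcal{P}^*([k])$ given by $c'(v)=\bigcup_{e\in E_v}c(e)$, where $E_v$ is the set of edges incident with $v$. The coloring $c$ is a strong royal $k$-edge coloring if $c'$ is vertex-distinguishing, i.e. $c'(u)\ne c'(v)$ for all distinct vertices $u,v$. The strong royal index $\mathrm{sroy}(G)$ is the minimum positive integer $k$ for which $G$ has a strong royal $k$-edge coloring. A connected graph $G$ of order $n\ge 3$, where $k$ is the unique integer with $2^{k-1}\le n\le 2^k-1$, is royal-zero if $\mathrm{sroy}(G)=k$ and royal-one if $\mathrm{sroy}(G)=k+1$. The corona $\mathrm{cor}(G)$ of $G$ is the graph obtained from $G$ by adding a pendant edge at each vertex of $G$ (so it has order $2n$). -}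

module Defs where

open import Data.Nat using (ℕ; zero; suc; _+_; _∸_; _^_; _≤_; _<_)
open import Data.Fin using (Fin; splitAt)
open import Data.Fin.Properties using () renaming (_≟_ to _≟F_)
open import Data.Fin.Subset using (Subset; ⊥; ⋃; Nonempty)
open import Data.Bool using (Bool; true; false; if_then_else_)
open import Data.List using (List; map; allFin)
open import Data.Sum using (_⊎_; inj₁; inj₂)
open import Data.Product using (Σ; _×_; _,_; ∃-syntax)
open import Relation.Nullary using (¬_; does; yes; no)
open import Data.Empty using (⊥-elim)
open import Relation.Binary.PropositionalEquality as Eq using (_≡_; refl)

record Graph (n : ℕ) : Set where
  field
    adj    : Fin n → Fin n → Bool
    sym    : ∀ u v → adj u v ≡ adj v u
    irrefl : ∀ v → adj v v ≡ false
open Graph public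

data Reachable {n : ℕ} (G : Graph n) : Fin n → Fin n → Set where
  here : ∀ {u} → Reachable G u u
  step : ∀ {u w v} → adj G u w ≡ true → Reachable G w v → Reachable G u v

Connected : {n : ℕ} → Graph n → Set
Connected {n} G = ∀ (u v : Fin n) → Reachable G u v

-- An edge coloring E(G) → P*([k]) : a color (nonempty subset of [k] = Fin k)
-- for every edge uv; the values on non-edges are irrelevant.
record EdgeColoring {n : ℕ} (G : Graph n) (k : ℕ) : Set where
  field
    col      : Fin n → Fin n → Subset k
    col-sym  : ∀ u v → adj G u v ≡ true → col u v ≡ col v u
    col-ne   : ∀ u v → adj G u v ≡ true → Nonempty (col u v)
open EdgeColoring public

induced : {n k : ℕ} {G : Graph n} → EdgeColoring G k → Fin n → Subset k
induced {n} {k} {G} c v =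
  ⋃ (map (λ u → if adj G v u then col c v u else ⊥) (allFin n))

IsStrongRoyal : {n k : ℕ} {G : Graph n} → EdgeColoring G k → Set
IsStrongRoyal {n} c = ∀ (u v : Fin n) → induced c u ≡ induced c v → u ≡ v

HasStrongRoyal : {n : ℕ} → Graph n → ℕ → Set
HasStrongRoyal G k = Σ (EdgeColoring G k) IsStrongRoyal

IsSroy : {n : ℕ} → Graph n → ℕ → Set
IsSroy G m = (1 ≤ m) × HasStrongRoyal G m × (∀ j → 1 ≤ j → j < m → ¬ HasStrongRoyal G j)

RoyalZero : {n : ℕ} → Graph n → Set
RoyalZero {n} G = ∃[ k ] (2 ^ (k ∸ 1) ≤ n × n < 2 ^ k × IsSroy G k)

-- corona: vertex set Fin (n + n); inj₁ i are the original vertices,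
-- inj₂ i is the new pendant vertex attached to i.
corAdj : {n : ℕ} → Graph n → Fin (n + n) → Fin (n + n) → Bool
corAdj {n} G x y with splitAt n x | splitAt n y
... | inj₁ i | inj₁ j = adj G i j
... | inj₁ i | inj₂ j = does (i ≟F j)
... | inj₂ i | inj₁ j = does (i ≟F j)
... | inj₂ i | inj₂ j = false


private
  ≟-sym : {n : ℕ} (i j : Fin n) → does (i ≟F j) ≡ does (j ≟F i)
  ≟-sym i j with i ≟F j | j ≟F i
  ... | yes _ | yes _ = refl
  ... | no _  | no _  = refl
  ... | yes p | no q  = ⊥-elim (q (Eq.sym p))
  ... | no p  | yes q = ⊥-elim (p (Eq.sym q))

  ≟-refl : {n : ℕ} (i : Fin n) → does (i ≟F i) ≡ true
  ≟-refl i with i ≟F i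
  ... | yes _ = refl
  ... | no p  = ⊥-elim (p refl)

corAdj-sym : {n : ℕ} (G : Graph n) → ∀ x y → corAdj G x y ≡ corAdj G y x
corAdj-sym {n} G x y with splitAt n x | splitAt n y
... | inj₁ i | inj₁ j = sym G i j
... | inj₁ i | inj₂ j = ≟-sym i j
... | inj₂ i | inj₁ j = ≟-sym i j
... | inj₂ i | inj₂ j = refl

corAdj-irrefl : {n : ℕ} (G : Graph n) → ∀ x → corAdj G x x ≡ false
corAdj-irrefl {n} G x with splitAt n x
... | inj₁ i = irrefl G i
... | inj₂ i = refl

cor : {n : ℕ} → Graph n → Graph (n + n)
cor G = record { adj = corAdj G ; sym = corAdj-sym G ; irrefl = corAdj-irrefl G }

module Submission where

-- Upper bound: a strong royal k-edge coloring c of G lifts to one of cor G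
-- with k+1 colours by a new leading bit: an edge ij of G gets inside ∷ c(ij)
-- and the pendant edge at i gets outside ∷ c'(i).  Then original vertex i
-- has induced colour inside ∷ c'(i) and its pendant vertex outside ∷ c'(i),
-- so the induced colouring stays injective.
--
-- Lower bound: without isolated vertices all induced colours are nonempty,
-- so a strong royal j-edge coloring of an order-N graph injects the N
-- colours together with ∅ into the 2^j subsets of [j]; hence N < 2^j.
-- For cor G of order 2n ≥ 2^k this excludes j ≤ k.

open import Defs hiding (sym)
open import Data.Nat using (ℕ; zero; suc; _+_; _^_; _≤_; _<_; z≤n; s≤s)
open import Data.Nat.Properties using (≤-trans; _≤?_; ≰⇒>; <-irrefl; <⇒≤; +-mono-≤; +-identityʳ; ^-monoʳ-≤)
open import Data.Fin using (Fin; splitAt; join; combine) renaming (zero to fzero; suc to fsuc)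
open import Data.Fin.Properties using (splitAt-join; join-splitAt; combine-injective; injective⇒≤) renaming (_≟_ to _≟F_)
open import Data.Fin.Subset using (Subset; ⊥; ⋃; Nonempty; _∈_; _⊆_; inside; outside)
open import Data.Fin.Subset.Properties using (∉⊥; x∈p∪q⁺; x∈p∪q⁻; ⊆-antisym; ⊆-refl; s⊆s; out⊆)
open import Data.Vec using ([]; _∷_; here; there)
open import Data.Vec.Properties using (∷-injectiveˡ; ∷-injectiveʳ)
open import Data.Bool using (Bool; true; false; if_then_else_)
open import Data.List using (List; map; allFin) renaming ([] to []ₗ; _∷_ to _∷ₗ_)
import Data.List.Membership.Propositional as List
open import Data.List.Membership.Propositional.Properties using (∈-allFin)
open import Data.List.Relation.Unary.Any using () renaming (here to hereₗ; there to thereₗ)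
open import Data.Sum using (_⊎_; inj₁; inj₂)
open import Data.Product using (_×_; _,_; proj₂; ∃-syntax)
open import Relation.Nullary using (¬_; does; yes; no)
open import Relation.Nullary.Decidable using (dec-true)
open import Data.Empty using (⊥-elim)
open import Relation.Binary.PropositionalEquality using (_≡_; _≢_; refl; sym; trans; cong; subst)

⋃-upper : ∀ {k} {A : Set} (f : A → Subset k) {xs : List A} {u : A} →
  u List.∈ xs → f u ⊆ ⋃ (map f xs)
⋃-upper f (hereₗ refl)  z∈ = x∈p∪q⁺ (inj₁ z∈)
⋃-upper f (thereₗ u∈xs) z∈ = x∈p∪q⁺ (inj₂ (⋃-upper f u∈xs z∈))

⋃-least : ∀ {k} {A : Set} (f : A → Subset k) (xs : List A) {S : Subset k} →
  (∀ u → f u ⊆ S) → ⋃ (map f xs) ⊆ S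
⋃-least f []ₗ       bound z∈ = ⊥-elim (∉⊥ z∈)
⋃-least f (x ∷ₗ xs) bound z∈ with x∈p∪q⁻ (f x) _ z∈
... | inj₁ z∈fx   = bound x z∈fx
... | inj₂ z∈rest = ⋃-least f xs bound z∈rest

module _ {n k : ℕ} {G : Graph n} (c : EdgeColoring G k) where

  contribution : Fin n → Fin n → Subset k
  contribution v u = if adj G v u then col c v u else ⊥

  col⊆induced : ∀ {v u} → adj G v u ≡ true → col c v u ⊆ induced c v
  col⊆induced {v} {u} vu =
    subst (λ b → (if b then col c v u else ⊥) ⊆ induced c v) vu
      (⋃-upper (contribution v) (∈-allFin u))

  induced-least : ∀ {v} {S : Subset k} →
    (∀ u → adj G v u ≡ true → col c v u ⊆ S) → induced c v ⊆ S
  induced-least {v} {S} bound = ⋃-least (contribution v) (allFin n) bound′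
    where
    bound′ : ∀ u → contribution v u ⊆ S
    bound′ u with adj G v u in vu
    ... | true  = bound u vu
    ... | false = λ z∈ → ⊥-elim (∉⊥ z∈)

  induced-nonempty : ∀ {v u} → adj G v u ≡ true → Nonempty (induced c v)
  induced-nonempty vu with col-ne c _ _ vu
  ... | z , z∈ = z , col⊆induced vu z∈

NoIsolatedVertex : {n : ℕ} → Graph n → Set
NoIsolatedVertex {n} G = ∀ (v : Fin n) → ∃[ u ] (adj G v u ≡ true)

-- a connected graph with at least two vertices has no isolated vertex:
-- a walk from v to a different vertex starts with an edge at v
connected⇒noIsolated : ∀ {n} (G : Graph n) → 2 ≤ n → Connected G → NoIsolatedVertex G
connected⇒noIsolated {suc zero} G (s≤s ()) conn v
connected⇒noIsolated {suc (suc n)} G _ conn v = firstStep (conn v (another v)) (another-≢ v)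
  where
  another : Fin (suc (suc n)) → Fin (suc (suc n))
  another fzero    = fsuc fzero
  another (fsuc _) = fzero

  another-≢ : ∀ w → w ≢ another w
  another-≢ fzero    ()
  another-≢ (fsuc _) ()

  firstStep : ∀ {u w} → Reachable G u w → u ≢ w → ∃[ x ] (adj G u x ≡ true)
  firstStep here               u≢u = ⊥-elim (u≢u refl)
  firstStep (step {w = x} ux _) _  = x , ux

bitIndex : Bool → Fin 2
bitIndex false = fzero
bitIndex true  = fsuc fzero

bitIndex-injective : ∀ {a b} → bitIndex a ≡ bitIndex b → a ≡ b
bitIndex-injective {false} {false} _ = refl
bitIndex-injective {true}  {true}  _ = refl
bitIndex-injective {false} {true}  ()
bitIndex-injective {true}  {false} ()

encode : ∀ {j} → Subset j → Fin (2 ^ j)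
encode []      = fzero
encode (b ∷ s) = combine (bitIndex b) (encode s)

encode-injective : ∀ {j} {s t : Subset j} → encode s ≡ encode t → s ≡ t
encode-injective {s = []}    {[]}    _ = refl
encode-injective {s = a ∷ s} {b ∷ t} e with combine-injective (bitIndex a) (encode s) (bitIndex b) (encode t) e
... | a≡b , s≡t with bitIndex-injective a≡b | encode-injective {s = s} {t} s≡t
... | refl | refl = refl

-- Counting bound: if H has no isolated vertex, its N induced colours under
-- a strong royal j-edge coloring are distinct nonempty subsets of [j], so
-- together with ∅ they give N + 1 distinct subsets and N < 2^j.
strongRoyal⇒order< : ∀ {N j} {H : Graph N} → NoIsolatedVertex H → HasStrongRoyal H j → N < 2 ^ j
strongRoyal⇒order< {N} {j} {H} noIso (c , royal) =
  injective⇒≤ {f = λ x → encode (colourOrEmpty x)} (λ e → colourOrEmpty-injective (encode-injective e))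
  where
  colourOrEmpty : Fin (suc N) → Subset j
  colourOrEmpty fzero    = ⊥
  colourOrEmpty (fsuc v) = induced c v

  colour≢∅ : ∀ v → induced c v ≢ ⊥
  colour≢∅ v c′v≡∅ with induced-nonempty c (proj₂ (noIso v))
  ... | z , z∈ = ∉⊥ (subst (z ∈_) c′v≡∅ z∈)

  colourOrEmpty-injective : ∀ {x y} → colourOrEmpty x ≡ colourOrEmpty y → x ≡ y
  colourOrEmpty-injective {fzero}  {fzero}  _ = refl
  colourOrEmpty-injective {fzero}  {fsuc y} e = ⊥-elim (colour≢∅ y (sym e))
  colourOrEmpty-injective {fsuc x} {fzero}  e = ⊥-elim (colour≢∅ x e)
  colourOrEmpty-injective {fsuc x} {fsuc y} e = cong fsuc (royal x y e)

module Corona {n : ℕ} (G : Graph n) where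

  Vertex : Set
  Vertex = Fin n ⊎ Fin n

  adjᶜ : Vertex → Vertex → Bool
  adjᶜ (inj₁ i) (inj₁ j) = adj G i j
  adjᶜ (inj₁ i) (inj₂ j) = does (i ≟F j)
  adjᶜ (inj₂ i) (inj₁ j) = does (i ≟F j)
  adjᶜ (inj₂ i) (inj₂ j) = false

  adj-split : ∀ x y → corAdj G x y ≡ adjᶜ (splitAt n x) (splitAt n y)
  adj-split x y with splitAt n x | splitAt n y
  ... | inj₁ i | inj₁ j = refl
  ... | inj₁ i | inj₂ j = refl
  ... | inj₂ i | inj₁ j = refl
  ... | inj₂ i | inj₂ j = refl

  adjacent-join : ∀ {x} t → adjᶜ (splitAt n x) t ≡ true → corAdj G x (join n n t) ≡ true
  adjacent-join {x} t xt =
    trans (adj-split x (join n n t))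
      (subst (λ t′ → adjᶜ (splitAt n x) t′ ≡ true) (sym (splitAt-join n n t)) xt)

  split-injective : ∀ {x y} → splitAt n x ≡ splitAt n y → x ≡ y
  split-injective {x} {y} e =
    trans (sym (join-splitAt n n x)) (trans (cong (join n n) e) (join-splitAt n n y))

  partner : Vertex → Vertex
  partner (inj₁ i) = inj₂ i
  partner (inj₂ i) = inj₁ i

  partner-adjacent : ∀ s → adjᶜ s (partner s) ≡ true
  partner-adjacent (inj₁ i) = dec-true (i ≟F i) refl
  partner-adjacent (inj₂ i) = dec-true (i ≟F i) refl

  corona-noIsolated : NoIsolatedVertex (cor G)
  corona-noIsolated x = join n n (partner (splitAt n x)) , adjacent-join (partner (splitAt n x)) (partner-adjacent (splitAt n x))

  module Lift {k : ℕ} (c : EdgeColoring G k) (noIso : NoIsolatedVertex G) where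

    colᶜ : Vertex → Vertex → Subset (suc k)
    colᶜ (inj₁ i) (inj₁ j) = inside ∷ col c i j
    colᶜ (inj₁ i) (inj₂ j) = outside ∷ induced c j
    colᶜ (inj₂ i) (inj₁ j) = outside ∷ induced c i
    colᶜ (inj₂ i) (inj₂ j) = ⊥

    colᶜ-sym : ∀ s t → adjᶜ s t ≡ true → colᶜ s t ≡ colᶜ t s
    colᶜ-sym (inj₁ i) (inj₁ j) ij = cong (inside ∷_) (col-sym c i j ij)
    colᶜ-sym (inj₁ i) (inj₂ j) _  = refl
    colᶜ-sym (inj₂ i) (inj₁ j) _  = refl

    spoke-nonempty : ∀ i → Nonempty (outside ∷ induced c i)
    spoke-nonempty i with induced-nonempty c (proj₂ (noIso i))
    ... | z , z∈ = fsuc z , there z∈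

    colᶜ-nonempty : ∀ s t → adjᶜ s t ≡ true → Nonempty (colᶜ s t)
    colᶜ-nonempty (inj₁ i) (inj₁ j) _ = fzero , here
    colᶜ-nonempty (inj₁ i) (inj₂ j) _ = spoke-nonempty j
    colᶜ-nonempty (inj₂ i) (inj₁ j) _ = spoke-nonempty i

    lifted : EdgeColoring (cor G) (suc k)
    lifted = record
      { col     = λ x y → colᶜ (splitAt n x) (splitAt n y)
      ; col-sym = λ x y xy → colᶜ-sym (splitAt n x) (splitAt n y) (trans (sym (adj-split x y)) xy)
      ; col-ne  = λ x y xy → colᶜ-nonempty (splitAt n x) (splitAt n y) (trans (sym (adj-split x y)) xy)
      }

    -- the predicted induced colour: the new bit records original/pendant
    label : Vertex → Subset (suc k)
    label (inj₁ i) = inside ∷ induced c i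
    label (inj₂ i) = outside ∷ induced c i

    colᶜ⊆label : ∀ s t → adjᶜ s t ≡ true → colᶜ s t ⊆ label s
    colᶜ⊆label (inj₁ i) (inj₁ j) ij = s⊆s (col⊆induced c ij)
    colᶜ⊆label (inj₁ i) (inj₂ j) ij with i ≟F j
    ... | yes refl = out⊆ ⊆-refl
    colᶜ⊆label (inj₂ i) (inj₁ j) _  = ⊆-refl

    -- label s is covered by two edges at s: an edge of G (giving the new
    -- bit) and the pendant edge (giving c'(i)); for a pendant vertex the
    -- pendant edge alone suffices
    label⊆colᶜ : ∀ s {S : Subset (suc k)} → (∀ t → adjᶜ s t ≡ true → colᶜ s t ⊆ S) → label s ⊆ S
    label⊆colᶜ (inj₁ i) cover here       = let (j , ij) = noIso i in cover (inj₁ j) ij here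
    label⊆colᶜ (inj₁ i) cover (there z∈) = cover (inj₂ i) (partner-adjacent (inj₁ i)) (there z∈)
    label⊆colᶜ (inj₂ i) cover            = cover (inj₁ i) (partner-adjacent (inj₂ i))

    induced-lifted : ∀ x → induced lifted x ≡ label (splitAt n x)
    induced-lifted x = ⊆-antisym
      (induced-least lifted (λ u xu → colᶜ⊆label _ _ (trans (sym (adj-split x u)) xu)))
      (label⊆colᶜ _ λ t xt →
        subst (λ t′ → colᶜ (splitAt n x) t′ ⊆ induced lifted x) (splitAt-join n n t)
          (col⊆induced lifted (adjacent-join t xt)))

    label-injective : IsStrongRoyal c → ∀ s t → label s ≡ label t → s ≡ t
    label-injective royal (inj₁ i) (inj₁ j) e = cong inj₁ (royal i j (∷-injectiveʳ e))
    label-injective royal (inj₂ i) (inj₂ j) e = cong inj₂ (royal i j (∷-injectiveʳ e))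
    label-injective royal (inj₁ i) (inj₂ j) e with ∷-injectiveˡ e
    ... | ()
    label-injective royal (inj₂ i) (inj₁ j) e with ∷-injectiveˡ e
    ... | ()

    lifted-royal : IsStrongRoyal c → IsStrongRoyal lifted
    lifted-royal royal x y e = split-injective (label-injective royal _ _
      (trans (sym (induced-lifted x)) (trans e (induced-lifted y))))

  corona-strongRoyal : ∀ {k} → NoIsolatedVertex G → HasStrongRoyal G k → HasStrongRoyal (cor G) (suc k)
  corona-strongRoyal noIso (c , royal) = Lift.lifted c noIso , Lift.lifted-royal c noIso royal

sroy-minimal : ∀ {N m j} {H : Graph N} → IsSroy H m → 1 ≤ j → HasStrongRoyal H j → m ≤ j
sroy-minimal {m = m} {j} (_ , _ , noneBelow) 1≤j h with m ≤? j
... | yes m≤j = m≤j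
... | no  m≰j = ⊥-elim (noneBelow j 1≤j (≰⇒> m≰j) h)

order-doubles : ∀ k n → 2 ^ k ≤ n → n < 2 ^ suc k →
  2 ^ suc k ≤ n + n × n + n < 2 ^ suc (suc k)
order-doubles k n lo hi =
  +-mono-≤ lo (subst (_≤ n) (sym (+-identityʳ _)) lo) ,
  +-mono-≤ hi (subst (n ≤_) (sym (+-identityʳ _)) (<⇒≤ hi))

proposition2p2 : (n : ℕ) (G : Graph n) → 4 ≤ n → Connected G →
    ((m m′ : ℕ) → IsSroy G m → IsSroy (cor G) m′ → m′ ≤ suc m)
    × (RoyalZero G → RoyalZero (cor G))
proposition2p2 n G 4≤n conn = sroy-bound , royalZero-preserved
  where
  noIso : NoIsolatedVertex G
  noIso = connected⇒noIsolated G (≤-trans (s≤s (s≤s z≤n)) 4≤n) conn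

  sroy-bound : (m m′ : ℕ) → IsSroy G m → IsSroy (cor G) m′ → m′ ≤ suc m
  sroy-bound m m′ (_ , royal , _) sroy′ =
    sroy-minimal sroy′ (s≤s z≤n) (Corona.corona-strongRoyal G noIso royal)

  -- if sroy(G) = k+1 with 2^k ≤ n < 2^(k+1), then sroy(cor G) = k+2:
  -- the lift gives k+2 colours, and the counting bound excludes ≤ k+1
  royalZero-preserved : RoyalZero G → RoyalZero (cor G)
  royalZero-preserved (zero , _ , _ , () , _)
  royalZero-preserved (suc k , lo , hi , _ , royal , _) with order-doubles k n lo hi
  ... | lo′ , hi′ =
    suc (suc k) , lo′ , hi′ , s≤s z≤n , Corona.corona-strongRoyal G noIso royal , tooFew
    where
    tooFew : ∀ j → 1 ≤ j → j < suc (suc k) → ¬ HasStrongRoyal (cor G) j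
    tooFew j _ (s≤s j≤k+1) h = <-irrefl refl
      (≤-trans (strongRoyal⇒order< (Corona.corona-noIsolated G) h) (≤-trans (^-monoʳ-≤ 2 j≤k+1) lo′))
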